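{- The axiom system $\mathsf{EKB}$ is sound for $\mathcal{L}_{E,K,B}$ with respect to the class of evidence models satisfying (E1) under doxastic-evidence semantics: every theorem of $\mathsf{EKB}$ is true at every doxastic evidence scenario of every evidence model satisfying (E1).
   Context: $\mathcal{L}_{E,K,B}$ is generated by $\phi ::= p \mid \neg\phi \mid \phi\wedge\psi \mid E\phi \mid K\phi \mid B\phi$, $p$ in a countable set $\textsc{prop}$. An evidence model is $(X,\mathcal{E},I,v)$ with $X$ nonempty, $\mathcal{E}$ a nonempty set, $I_e:X\to 2^X$ for each $e\in\mathcal{E}$, $v:\textsc{prop}\to 2^X$. Let $U_e=\{x : x\in I_e(x)\}$. Condition (E1): $y\in I_e(x)$ implies $y\in I_e(y)$. A doxastic evidence scenario is a triple $(x,e,V)$ with $x\in U_e$ and $\emptyset\neq V\subseteq U_e$. Doxastic-evidence semantics: $(x,e,V)\models p$ iff $x\in v(p)$; Booleans as usual; $(x,e,V)\models E\phi$ iff $I_e(x)\subseteq[\![\phi]\!]^{e,V}$; $(x,e,V)\models K\phi$ iff $U_e\subseteq[\![\phi]\!]^{e,V}$; $(x,e,V)\models B\phi$ iff $V\subseteq[\![\phi]\!]^{e,V}$, where $[\![\phi]\!]^{e,V}=\{y\in U_e : (y,e,V)\models\phi\}$. $\mathsf{EKB}$ consists of: classical propositional logic with modus ponens; $\mathsf{S5}$ for $K$ (axioms K, T, 4, 5 and necessitation); $\mathsf{KT}$ for $E$ (axioms K, T and necessitation); $K\phi\to E\phi$; $B(\phi\to\psi)\to(B\phi\to B\psi)$;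 $B\phi\to\neg B\neg\phi$; $B\phi\to KB\phi$; and $K\phi\to B\phi$. -}

module Defs where

open import Data.Nat using (ℕ)
open import Data.Bool using (Bool; true; false; not; _∧_)
open import Data.Product using (_×_; ∃)
open import Data.Empty using (⊥)
open import Relation.Binary.PropositionalEquality using (_≡_)
open import Level using (0ℓ)

Prop : Set
Prop = ℕ

data Form : Set where
  atom : Prop → Form
  ¬'_  : Form → Form
  _∧'_ : Form → Form → Form
  E'   : Form → Form
  K'   : Form → Form
  B'   : Form → Form

infixr 6 _∧'_
infixr 4 _⇒_

_⇒_ : Form → Form → Form
φ ⇒ ψ = ¬' (φ ∧' ¬' ψ)

-- Classical propositional tautologies: formulas true under every Boolean
-- valuation of their propositional skeleton (atoms and modal subformulas
-- are treated as propositional atoms).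
evalB : (Form → Bool) → Form → Bool
evalB f (atom p) = f (atom p)
evalB f (¬' φ)   = not (evalB f φ)
evalB f (φ ∧' ψ) = evalB f φ ∧ evalB f ψ
evalB f (E' φ)   = f (E' φ)
evalB f (K' φ)   = f (K' φ)
evalB f (B' φ)   = f (B' φ)

Tautology : Form → Set
Tautology φ = (f : Form → Bool) → evalB f φ ≡ true

data ⊢_ : Form → Set where
  taut  : ∀ {φ} → Tautology φ → ⊢ φ
  mp    : ∀ {φ ψ} → ⊢ (φ ⇒ ψ) → ⊢ φ → ⊢ ψ
  K-K   : ∀ {φ ψ} → ⊢ (K' (φ ⇒ ψ) ⇒ (K' φ ⇒ K' ψ))
  K-T   : ∀ {φ} → ⊢ (K' φ ⇒ φ)
  K-4   : ∀ {φ} → ⊢ (K' φ ⇒ K' (K' φ))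
  K-5   : ∀ {φ} → ⊢ (¬' (K' φ) ⇒ K' (¬' (K' φ)))
  K-nec : ∀ {φ} → ⊢ φ → ⊢ K' φ
  E-K   : ∀ {φ ψ} → ⊢ (E' (φ ⇒ ψ) ⇒ (E' φ ⇒ E' ψ))
  E-T   : ∀ {φ} → ⊢ (E' φ ⇒ φ)
  E-nec : ∀ {φ} → ⊢ φ → ⊢ E' φ
  KE    : ∀ {φ} → ⊢ (K' φ ⇒ E' φ)
  B-K   : ∀ {φ ψ} → ⊢ (B' (φ ⇒ ψ) ⇒ (B' φ ⇒ B' ψ))
  B-D   : ∀ {φ} → ⊢ (B' φ ⇒ ¬' (B' (¬' φ)))
  B-KB  : ∀ {φ} → ⊢ (B' φ ⇒ K' (B' φ))
  K-B   : ∀ {φ} → ⊢ (K' φ ⇒ B' φ)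

infix 2 ⊢_

record EvidenceModel : Set₁ where
  field
    X   : Set
    x₀  : X
    Ev  : Set
    e₀  : Ev
    I   : Ev → X → X → Set       -- I e x y  means  y ∈ I_e(x)
    val : Prop → X → Set         -- val p x  means  x ∈ v(p)

  U : Ev → X → Set
  U e x = I e x x

E1 : EvidenceModel → Set
E1 M = ∀ e x y → I e x y → I e y y
  where open EvidenceModel M

module Semantics (M : EvidenceModel) where
  open EvidenceModel M

  sat : X → Ev → (X → Set) → Form → Set
  sat x e V (atom p) = val p x
  sat x e V (¬' φ)   = sat x e V φ → ⊥
  sat x e V (φ ∧' ψ) = sat x e V φ × sat x e V ψ
  sat x e V (E' φ)   = ∀ y → I e x y → (U e y × sat y e V φ)
  sat x e V (K' φ)   = ∀ y → U e y → sat y e V φ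
  sat x e V (B' φ)   = ∀ y → V y → sat y e V φ

  Scenario : X → Ev → (X → Set) → Set
  Scenario x e V = U e x × (∃ λ y → V y) × (∀ y → V y → U e y)

module Submission where

-- We show by induction on derivations that every
-- theorem of EKB holds at every point of U_e (with e and V fixed); the
-- theorem then follows because a scenario (x, e, V) has x ∈ U_e.
--
-- The metatheory is classical (excluded middle is a hypothesis), which is
-- needed in two places:
--   * implication φ ⇒ ψ is encoded as ¬(φ ∧ ¬ψ), so modus ponens needs
--     double-negation elimination;
--   * tautologies are validated by reading off a Boolean valuation of the
--     modal/atomic subformulas from their truth at a point and showing
--     that evalB under this valuation reflects satisfaction.
-- The modal axioms are then checked one by one from the semantic clauses:
-- K and B quantify over fixed sets (U_e and V), which makes K an S5
-- modality and B a KD modality whose truth does not depend on the point;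
-- (E1) is used exactly for E-necessitation and
-- K φ → E φ, where points of I_e(x) must be shown to lie in U_e.

open import Defs
open import Level using (0ℓ)
open import Axiom.ExcludedMiddle using (ExcludedMiddle)
open import Data.Bool using (Bool)
open import Data.Product using (_,_; proj₁; proj₂; ∃)
open import Relation.Nullary using (does; proof)
open import Relation.Nullary.Decidable using (decidable-stable)
open import Relation.Nullary.Reflects using (Reflects; invert; ¬-reflects; _×-reflects_)
open import Relation.Binary.PropositionalEquality using (subst)

module Soundness (lem : ExcludedMiddle 0ℓ) (M : EvidenceModel) (e1 : E1 M) where
  open EvidenceModel M
  open Semantics M

  module _ (e : Ev) (V : X → Set) where

    _⊨_ : X → Form → Set
    x ⊨ φ = sat x e V φ

    ⇒-intro : ∀ x φ ψ → (x ⊨ φ → x ⊨ ψ) → x ⊨ (φ ⇒ ψ)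
    ⇒-intro x φ ψ f (a , ¬b) = ¬b (f a)

    ⇒-elim : ∀ x φ ψ → x ⊨ (φ ⇒ ψ) → x ⊨ φ → x ⊨ ψ
    ⇒-elim x φ ψ h a = decidable-stable lem (λ ¬b → h (a , ¬b))

    distribute : (R : X → Set) (φ ψ : Form) →
                 (∀ y → R y → y ⊨ (φ ⇒ ψ)) → (∀ y → R y → y ⊨ φ) →
                 ∀ y → R y → y ⊨ ψ
    distribute R φ ψ h k y r = ⇒-elim y φ ψ (h y r) (k y r)

    truth : X → Form → Bool
    truth x φ = does (lem {x ⊨ φ})

    evalB-reflects : ∀ x φ → Reflects (x ⊨ φ) (evalB (truth x) φ)
    evalB-reflects x (atom p) = proof lem
    evalB-reflects x (¬' φ)   = ¬-reflects (evalB-reflects x φ)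
    evalB-reflects x (φ ∧' ψ) = evalB-reflects x φ ×-reflects evalB-reflects x ψ
    evalB-reflects x (E' φ)   = proof lem
    evalB-reflects x (K' φ)   = proof lem
    evalB-reflects x (B' φ)   = proof lem

    tautology-true : ∀ φ → Tautology φ → ∀ x → x ⊨ φ
    tautology-true φ t x = invert (subst (Reflects (x ⊨ φ)) (t (truth x)) (evalB-reflects x φ))

    -- Soundness at a fixed (e, V): every theorem holds throughout U_e,
    -- provided V is nonempty (for axiom D) and V ⊆ U_e (for K φ → B φ).
    sound : (∃ λ y → V y) → (∀ y → V y → U e y) →
            ∀ {φ} → ⊢ φ → ∀ x → U e x → x ⊨ φ
    sound V≠∅ V⊆U = go
      where
      go : ∀ {φ} → ⊢ φ → ∀ x → U e x → x ⊨ φ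
      go (taut {φ} t)       x _  = tautology-true φ t x
      go (mp {φ} {ψ} d d')  x ux = ⇒-elim x φ ψ (go d x ux) (go d' x ux)
      go (K-K {φ} {ψ})      x _  = ⇒-intro x (K' (φ ⇒ ψ)) (K' φ ⇒ K' ψ) λ h →
                                     ⇒-intro x (K' φ) (K' ψ) (distribute (U e) φ ψ h)
      go (K-T {φ})          x ux = ⇒-intro x (K' φ) φ λ k → k x ux
      go (K-4 {φ})          x _  = ⇒-intro x (K' φ) (K' (K' φ)) λ k _ _ → k
      go (K-5 {φ})          x _  = ⇒-intro x (¬' (K' φ)) (K' (¬' (K' φ))) λ ¬k _ _ → ¬k
      go (K-nec d)          x _  = go d
      go (E-K {φ} {ψ})      x _  = ⇒-intro x (E' (φ ⇒ ψ)) (E' φ ⇒ E' ψ) λ h →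
                                     ⇒-intro x (E' φ) (E' ψ) λ k y i →
                                       proj₁ (h y i) , ⇒-elim y φ ψ (proj₂ (h y i)) (proj₂ (k y i))
      go (E-T {φ})          x ux = ⇒-intro x (E' φ) φ λ k → proj₂ (k x ux)
      go (E-nec d)          x _  = λ y i → e1 e x y i , go d y (e1 e x y i)
      go (KE {φ})           x _  = ⇒-intro x (K' φ) (E' φ) λ k y i → e1 e x y i , k y (e1 e x y i)
      go (B-K {φ} {ψ})      x _  = ⇒-intro x (B' (φ ⇒ ψ)) (B' φ ⇒ B' ψ) λ h →
                                     ⇒-intro x (B' φ) (B' ψ) (distribute V φ ψ h)
      go (B-D {φ})          x _  = ⇒-intro x (B' φ) (¬' (B' (¬' φ))) λ b ¬b →
                                     let (y , vy) = V≠∅ in ¬b y vy (b y vy)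
      go (B-KB {φ})         x _  = ⇒-intro x (B' φ) (K' (B' φ)) λ b _ _ → b
      go (K-B {φ})          x _  = ⇒-intro x (K' φ) (B' φ) λ k y vy → k y (V⊆U y vy)

theorem3 : ExcludedMiddle 0ℓ →
    (φ : Form) → ⊢ φ →
    (M : EvidenceModel) → E1 M →
    ∀ x e V → Semantics.Scenario M x e V → Semantics.sat M x e V φ
theorem3 lem φ ⊢φ M e1 x e V (x∈U , V≠∅ , V⊆U) =
  Soundness.sound lem M e1 e V V≠∅ V⊆U ⊢φ x x∈U
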